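{- Let $\mathbf u$ be an infinite word over a finite alphabet whose language is closed under reversal and whose defect $D(\mathbf u)$ is finite. Let $q$ be a prefix of $\mathbf u$ with $D(q)=D(\mathbf u)$. Then for every prefix $p$ of $\mathbf u$ with $|p|>|q|$, $$\#\{x\in\mathcal L(p): x \text{ is a palindrome},\ |x|\le |q|,\ x\notin\mathcal L(q)\}+\sum_{n=|q|+1}^{|p|}\mathcal P_p(n)=|p|-|q|.$$
   Context: For a finite word $w=w_0\cdots w_{n-1}$ its reversal is $\overline{w}=w_{n-1}\cdots w_0$; $w$ is a palindrome if $w=\overline{w}$. $\mathcal L(v)$ denotes the set of factors of a (finite or infinite) word $v$. The language of $\mathbf u$ is closed under reversal if $w\in\mathcal L(\mathbf u)$ implies $\overline{w}\in\mathcal L(\mathbf u)$. The defect of a finite word $w$ is $D(w)=|w|+1-(\text{number of distinct palindromic factors of } w, \text{ including the empty word})$, and $D(\mathbf u)=\sup\{D(w): w \text{ a prefix of } \mathbf u\}$. For a finite word $p$, $\mathcal P_p(n)$ is the number of distinct palindromic factors of $p$ of length $n$. -}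

module Defs where

open import Data.Nat using (ℕ; zero; suc; _+_; _∸_; _≤_; _≤?_)
open import Data.Fin using (Fin; toℕ)
import Data.Fin.Properties as FinP
open import Data.List using (List; []; _∷_; length; take; drop; map; concatMap; upTo; tabulate; filter; deduplicate; reverse)
open import Data.Nat.ListAction using (sum)
import Data.List.Properties as LP
open import Data.List.Membership.Propositional using (_∈_)
import Data.List.Membership.DecPropositional as DecMem
open import Data.Product using (Σ; _×_)
open import Relation.Binary.PropositionalEquality using (_≡_)
open import Relation.Nullary using (Dec; ¬_)
open import Relation.Nullary.Decidable using (_×-dec_; ¬?)

Word : ℕ → Set
Word k = List (Fin k)

InfWord : ℕ → Set
InfWord k = ℕ → Fin k

pref : ∀ {k} → InfWord k → ℕ → Word k
pref u n = tabulate {n = n} (λ i → u (toℕ i))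

InfFactor : ∀ {k} → InfWord k → Word k → Set
InfFactor u w = Σ ℕ λ i → pref (λ j → u (i + j)) (length w) ≡ w

ClosedUnderReversal : ∀ {k} → InfWord k → Set
ClosedUnderReversal u = ∀ w → InfFactor u w → InfFactor u (reverse w)

module _ {k : ℕ} where
  _≟w_ : (x y : Word k) → Dec (x ≡ y)
  _≟w_ = LP.≡-dec FinP._≟_

  open DecMem _≟w_ using (_∈?_)

  allFactors : Word k → List (Word k)
  allFactors p = concatMap (λ i → map (λ l → take l (drop i p)) (upTo (suc (length p ∸ i))))
                           (upTo (suc (length p)))

  factors : Word k → List (Word k)
  factors p = deduplicate _≟w_ (allFactors p)

  isFactor? : (x p : Word k) → Dec (x ∈ factors p)
  isFactor? x p = x ∈? factors p

  IsPal : Word k → Set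
  IsPal w = w ≡ reverse w

  isPal? : (w : Word k) → Dec (IsPal w)
  isPal? w = w ≟w reverse w

  -- Number of distinct palindromic factors of p (including the empty word).
  numPal : Word k → ℕ
  numPal p = length (filter isPal? (factors p))

  -- Defect D(w) = |w| + 1 - #palindromic factors (this count is always ≤ |w|+1).
  defect : Word k → ℕ
  defect w = suc (length w) ∸ numPal w

  palCount : Word k → ℕ → ℕ
  palCount p n = length (filter (λ x → isPal? x ×-dec (length x Data.Nat.≟ n)) (factors p))

  newPalCount : (p q : Word k) → ℕ → ℕ
  newPalCount p q m =
    length (filter (λ x → isPal? x ×-dec ((length x ≤? m) ×-dec ¬? (isFactor? x q))) (factors p))

sumFromTo : (ℕ → ℕ) → ℕ → ℕ → ℕ
sumFromTo f a b = sum (map (λ i → f (suc (a + i))) (upTo (b ∸ a)))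

FiniteDefect : ∀ {k} → InfWord k → Set
FiniteDefect u = Σ ℕ λ B → ∀ n → defect (pref u n) ≤ B

IsDefectOf : ∀ {k} → InfWord k → ℕ → Set
IsDefectOf u d = (∀ n → defect (pref u n) ≤ d) × (∀ b → (∀ n → defect (pref u n) ≤ b) → d ≤ b)

-- Appending one letter a to a finite word w creates at most one new
-- palindromic factor: a new factor must be a suffix of w a, and of two
-- palindromic suffixes the shorter one is also a prefix of the longer, so it
-- already occurs in w unless the two coincide.  Hence the number of
-- palindromic factors of the prefix of length n grows by at most one per
-- letter, i.e. the defect of prefixes is non-decreasing in n.  If the prefix q
-- of length m already attains the supremum D(u), the defect is constant from
-- m on, so every further letter creates exactly one palindrome and a prefix p
-- of length N > m has exactly N - m palindromic factors that are not factors
-- of q.  Sorting those by length -- at most m, or one of m+1, ..., N (such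
-- long words cannot occur in q at all) -- gives the identity.

module Submission where

open import Defs
open import Data.Nat using (ℕ; zero; suc; _+_; _∸_; _<_; _≤_; _≤?_; _<?_; _≟_; z≤n; s≤s)
open import Data.Nat.Properties
  using (≤-refl; ≤-reflexive; ≤-trans; ≤-antisym; <⇒≤; <⇒≱; ≰⇒>; <-irrefl; n≤1+n; m≤m+n; +-suc; +-identityʳ;
         +-assoc; +-comm; +-cancelˡ-≡; +-cancelʳ-≡; +-monoˡ-≤; m+n∸m≡n; m+[n∸m]≡n; ∸-monoʳ-≤)
open import Data.Nat.ListAction using (sum)
open import Data.Nat.ListAction.Properties using (sum-++)
open import Data.Fin using (Fin)
open import Data.List
  using (List; []; _∷_; [_]; _++_; _∷ʳ_; length; take; drop; map; upTo; filter; reverse;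
         InitLast; initLast; _∷ʳ′_)
import Data.List.Properties as LP
open import Data.List.Membership.Propositional using (_∈_; lose)
open import Data.List.Membership.Propositional.Properties
  using (∈-filter⁺; ∈-filter⁻; ∈-map⁺; ∈-map⁻; ∈-concatMap⁺; ∈-concatMap⁻; ∈-upTo⁺;
         ∈-deduplicate⁺; ∈-deduplicate⁻)
open import Data.List.Membership.Propositional.Properties.WithK using (unique∧set⇒bag)
open import Data.List.Relation.Binary.BagAndSetEquality using (∼bag⇒↭)
open import Data.List.Relation.Binary.Permutation.Propositional.Properties using (↭-length)
open import Data.List.Relation.Unary.All using (tabulate; _∷_)
open import Data.List.Relation.Unary.Any using (here; there; satisfied)
open import Data.List.Relation.Unary.AllPairs using (_∷_)
open import Data.List.Relation.Unary.Unique.Propositional using (Unique)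
import Data.List.Relation.Unary.Unique.Propositional.Properties as Unique
import Data.List.Relation.Unary.Unique.DecPropositional.Properties as DecUnique
open import Data.Product using (Σ; _×_; _,_)
open import Data.Sum using (_⊎_; inj₁; inj₂) renaming ([_,_] to either)
open import Data.Empty using (⊥-elim)
open import Function using (_∘_)
open import Function.Bundles using (mk⇔)
open import Relation.Binary.PropositionalEquality using (_≡_; refl; sym; trans; cong; cong₂; subst; subst₂; module ≡-Reasoning)
open import Relation.Nullary using (¬_; yes; no)
open import Relation.Nullary.Decidable using (_×-dec_; ¬?)
open import Relation.Unary using (Decidable)

module Counting {A : Set} where

  count : {P : A → Set} → Decidable P → List A → ℕ
  count P? xs = length (filter P? xs)

  count-⊎ : {R P Q : A → Set} (R? : Decidable R) (P? : Decidable P) (Q? : Decidable Q) (xs : List A) →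
    (∀ {x} → x ∈ xs → R x → P x ⊎ Q x) → (∀ {x} → x ∈ xs → P x ⊎ Q x → R x) →
    (∀ {x} → x ∈ xs → P x → ¬ Q x) →
    count R? xs ≡ count P? xs + count Q? xs
  count-⊎ R? P? Q? [] _ _ _ = refl
  count-⊎ R? P? Q? (x ∷ xs) split join disjoint
    with count-⊎ R? P? Q? xs (λ m → split (there m)) (λ m → join (there m)) (λ m → disjoint (there m))
       | R? x | P? x | Q? x
  ... | _  | _     | yes p | yes q = ⊥-elim (disjoint (here refl) p q)
  ... | ih | yes _ | yes _ | no _  = cong suc ih
  ... | ih | yes _ | no _  | yes _ = trans (cong suc ih) (sym (+-suc _ _))
  ... | _  | yes r | no ¬p | no ¬q = ⊥-elim (either ¬p ¬q (split (here refl) r))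
  ... | _  | no ¬r | yes p | _     = ⊥-elim (¬r (join (here refl) (inj₁ p)))
  ... | _  | no ¬r | no _  | yes q = ⊥-elim (¬r (join (here refl) (inj₂ q)))
  ... | ih | no _  | no _  | no _  = ih

  count-none : {P : A → Set} (P? : Decidable P) (xs : List A) → (∀ {x} → x ∈ xs → ¬ P x) → count P? xs ≡ 0
  count-none P? xs none = cong length (LP.filter-none P? (tabulate none))

  unique-length : {xs ys : List A} → Unique xs → Unique ys →
    (∀ {z} → z ∈ xs → z ∈ ys) → (∀ {z} → z ∈ ys → z ∈ xs) → length xs ≡ length ys
  unique-length ux uy to from = ↭-length (∼bag⇒↭ (unique∧set⇒bag ux uy (mk⇔ to from)))

  count-transfer : {P Q : A → Set} (P? : Decidable P) (Q? : Decidable Q) {xs ys : List A} →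
    Unique xs → Unique ys →
    (∀ {x} → x ∈ xs → P x → x ∈ ys × Q x) → (∀ {x} → x ∈ ys → Q x → x ∈ xs × P x) →
    count P? xs ≡ count Q? ys
  count-transfer P? Q? ux uy to from =
    unique-length (Unique.filter⁺ P? ux) (Unique.filter⁺ Q? uy) (transport P? Q? to) (transport Q? P? from)
    where
    transport : {P Q : A → Set} (P? : Decidable P) (Q? : Decidable Q) {xs ys : List A} →
      (∀ {x} → x ∈ xs → P x → x ∈ ys × Q x) → ∀ {z} → z ∈ filter P? xs → z ∈ filter Q? ys
    transport P? Q? f z∈ with (m , p) ← ∈-filter⁻ P? z∈ with (m' , q) ← f m p = ∈-filter⁺ Q? m' q

  count-≤1 : {P : A → Set} (P? : Decidable P) {xs : List A} → Unique xs →
    (∀ {x y} → x ∈ xs → P x → y ∈ xs → P y → x ≡ y) → count P? xs ≤ 1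
  count-≤1 P? {xs} ux atMostOne = singleton (Unique.filter⁺ P? ux) same
    where
    same : ∀ {x y} → x ∈ filter P? xs → y ∈ filter P? xs → x ≡ y
    same mx my with (mx' , px) ← ∈-filter⁻ P? mx | (my' , py) ← ∈-filter⁻ P? my = atMostOne mx' px my' py
    singleton : {zs : List A} → Unique zs → (∀ {x y} → x ∈ zs → y ∈ zs → x ≡ y) → length zs ≤ 1
    singleton {[]} _ _ = z≤n
    singleton {_ ∷ []} _ _ = s≤s z≤n
    singleton {_ ∷ _ ∷ _} ((x≢y ∷ _) ∷ _) eq = ⊥-elim (x≢y (eq (here refl) (there (here refl))))

open Counting

sum-count-by-length : {B : Set} {P : List B → Set} (P? : Decidable P) (xs : List (List B)) (a K : ℕ) →
  sum (map (λ i → count (λ x → P? x ×-dec (length x ≟ suc (a + i))) xs) (upTo K)) ≡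
  count (λ x → P? x ×-dec ((a <? length x) ×-dec (length x ≤? a + K))) xs
sum-count-by-length P? xs a zero =
  sym (count-none _ xs (λ _ (_ , a<l , l≤a+0) → <⇒≱ a<l (subst (_ ≤_) (+-identityʳ a) l≤a+0)))
sum-count-by-length {P = P} P? xs a (suc K) = begin
  sum (map exactly (upTo (suc K)))              ≡⟨ cong (sum ∘ map exactly) (sym (LP.upTo-∷ʳ K)) ⟩
  sum (map exactly (upTo K ∷ʳ K))               ≡⟨ cong sum (LP.map-++ exactly (upTo K) [ K ]) ⟩
  sum (map exactly (upTo K) ++ [ exactly K ])   ≡⟨ sum-++ (map exactly (upTo K)) [ exactly K ] ⟩
  sum (map exactly (upTo K)) + (exactly K + 0)  ≡⟨ cong₂ _+_ (sum-count-by-length P? xs a K) (+-identityʳ _) ⟩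
  count (within K) xs + exactly K               ≡⟨ sym (count-⊎ (within (suc K)) (within K) (exact? K) xs
                                                         (λ _ → split) (λ _ → join) (λ _ → disjoint)) ⟩
  count (within (suc K)) xs                     ∎
  where
  open ≡-Reasoning
  exact? : ∀ i → Decidable (λ x → P x × length x ≡ suc (a + i))
  exact? i x = P? x ×-dec (length x ≟ suc (a + i))
  exactly : ℕ → ℕ
  exactly i = count (exact? i) xs
  within : ∀ n → Decidable (λ x → P x × (a < length x × length x ≤ a + n))
  within n x = P? x ×-dec ((a <? length x) ×-dec (length x ≤? a + n))
  split : ∀ {x} → P x × (a < length x × length x ≤ a + suc K) →
          P x × (a < length x × length x ≤ a + K) ⊎ P x × length x ≡ suc (a + K)
  split {x} (p , a<l , l≤) with length x ≤? a + K
  ... | yes l≤a+K = inj₁ (p , a<l , l≤a+K)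
  ... | no l≰a+K  = inj₂ (p , ≤-antisym (subst (length x ≤_) (+-suc a K) l≤) (≰⇒> l≰a+K))
  join : ∀ {x} → P x × (a < length x × length x ≤ a + K) ⊎ P x × length x ≡ suc (a + K) →
         P x × (a < length x × length x ≤ a + suc K)
  join (inj₁ (p , a<l , l≤)) = p , a<l , ≤-trans l≤ (subst (a + K ≤_) (sym (+-suc a K)) (n≤1+n _))
  join (inj₂ (p , l≡)) = p , subst (a <_) (sym l≡) (s≤s (m≤m+n a K)) , subst₂ _≤_ (sym l≡) (sym (+-suc a K)) ≤-refl
  disjoint : ∀ {x} → P x × (a < length x × length x ≤ a + K) → ¬ (P x × length x ≡ suc (a + K))
  disjoint (_ , _ , l≤) (_ , l≡) = <-irrefl refl (subst (_≤ a + K) l≡ l≤)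

take-length-++ : ∀ {A : Set} (xs ys : List A) → take (length xs) (xs ++ ys) ≡ xs
take-length-++ []       ys = refl
take-length-++ (x ∷ xs) ys = cong (x ∷_) (take-length-++ xs ys)

drop-length-++ : ∀ {A : Set} (xs ys : List A) → drop (length xs) (xs ++ ys) ≡ ys
drop-length-++ []       ys = refl
drop-length-++ (x ∷ xs) ys = drop-length-++ xs ys

suffixes-comparable : ∀ {A : Set} (α x β y : List A) → α ++ x ≡ β ++ y →
  (Σ (List A) λ δ → y ≡ δ ++ x) ⊎ (Σ (List A) λ δ → x ≡ δ ++ y)
suffixes-comparable []      x β       y e = inj₂ (β , e)
suffixes-comparable (a ∷ α) x []      y e = inj₁ (a ∷ α , sym e)
suffixes-comparable (a ∷ α) x (b ∷ β) y e = suffixes-comparable α x β y (LP.∷-injectiveʳ e)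

module Factors {k : ℕ} where

  Factor : Word k → Word k → Set
  Factor x p = Σ (Word k) λ α → Σ (Word k) λ β → α ++ (x ++ β) ≡ p

  factorsAt : Word k → ℕ → List (Word k)
  factorsAt p i = map (λ l → take l (drop i p)) (upTo (suc (length p ∸ i)))

  factors-sound : ∀ {x} p → x ∈ factors p → Factor x p
  factors-sound {x} p x∈
    with (i , x∈atα) ← satisfied (∈-concatMap⁻ (factorsAt p) {xs = upTo (suc (length p))}
                                   (∈-deduplicate⁻ _≟w_ (allFactors p) x∈))
    with (l , _ , x≡) ← ∈-map⁻ (λ l → take l (drop i p)) {xs = upTo (suc (length p ∸ i))} x∈atα
    = take i p , drop l (drop i p) , (begin
      take i p ++ (x ++ drop l (drop i p))                ≡⟨ cong (λ z → take i p ++ (z ++ drop l (drop i p))) x≡ ⟩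
      take i p ++ (take l (drop i p) ++ drop l (drop i p)) ≡⟨ cong (take i p ++_) (LP.take++drop≡id l (drop i p)) ⟩
      take i p ++ drop i p                                 ≡⟨ LP.take++drop≡id i p ⟩
      p                                                    ∎)
    where open ≡-Reasoning

  -- ... and every factor α x β of p is listed, at start |α| and length |x|.
  factors-complete : ∀ {x p} → Factor x p → x ∈ factors p
  factors-complete {x} (α , β , refl) =
    ∈-deduplicate⁺ _≟w_ (∈-concatMap⁺ (factorsAt p) {xs = upTo (suc (length p))} (lose (∈-upTo⁺ (s≤s start≤)) x∈atα))
    where
    p = α ++ (x ++ β)
    start≤ : length α ≤ length p
    start≤ = LP.length-++-≤ˡ α
    len≤ : length x ≤ length p ∸ length α
    len≤ = subst (length x ≤_) (sym (trans (cong (_∸ length α) (LP.length-++ α)) (m+n∸m≡n (length α) _)))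
                 (LP.length-++-≤ˡ x)
    window : take (length x) (drop (length α) p) ≡ x
    window = trans (cong (take (length x)) (drop-length-++ α (x ++ β))) (take-length-++ x β)
    x∈atα : x ∈ factorsAt p (length α)
    x∈atα = subst (_∈ factorsAt p (length α)) window (∈-map⁺ (λ l → take l (drop (length α) p)) (∈-upTo⁺ (s≤s len≤)))

  factors-unique : ∀ p → Unique (factors p)
  factors-unique p = DecUnique.deduplicate-! {A = Word k} _≟w_ (allFactors p)

  factor-length : ∀ {x p} → Factor x p → length x ≤ length p
  factor-length {x} (α , β , refl) = ≤-trans (LP.length-++-≤ˡ x) (LP.length-++-≤ʳ (x ++ β) {α})

  factor-++ : ∀ {x q} r → Factor x q → Factor x (q ++ r)
  factor-++ {x} r (α , β , refl) = α , β ++ r ,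
    sym (trans (LP.++-assoc α (x ++ β) r) (cong (α ++_) (LP.++-assoc x β r)))

open Factors

palindromic-suffix-is-prefix : ∀ {A : Set} {x y δ : List A} →
  x ≡ reverse x → y ≡ reverse y → y ≡ δ ++ x → y ≡ x ++ reverse δ
palindromic-suffix-is-prefix {x = x} {y} {δ} x-pal y-pal y≡δx = begin
  y                         ≡⟨ y-pal ⟩
  reverse y                 ≡⟨ cong reverse y≡δx ⟩
  reverse (δ ++ x)          ≡⟨ LP.reverse-++ δ x ⟩
  reverse x ++ reverse δ    ≡⟨ cong (_++ reverse δ) (sym x-pal) ⟩
  x ++ reverse δ            ∎
  where open ≡-Reasoning

module NewFactors {k : ℕ} {w : Word k} {a : Fin k} where

  occurs-before-last : ∀ α x β {b} → α ++ (x ++ (β ∷ʳ b)) ≡ w ∷ʳ a → Factor x w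
  occurs-before-last α x β {b} e = α , β , LP.∷ʳ-injectiveˡ (α ++ (x ++ β)) w (begin
    (α ++ (x ++ β)) ∷ʳ b     ≡⟨ LP.++-assoc α (x ++ β) [ b ] ⟩
    α ++ ((x ++ β) ∷ʳ b)     ≡⟨ cong (α ++_) (LP.++-assoc x β [ b ]) ⟩
    α ++ (x ++ (β ∷ʳ b))     ≡⟨ e ⟩
    w ∷ʳ a                   ∎)
    where open ≡-Reasoning

  new-occurrence-ends : ∀ α x ρ → α ++ (x ++ ρ) ≡ w ∷ʳ a → ¬ Factor x w → ρ ≡ []
  new-occurrence-ends α x ρ e new = by-last ρ (initLast ρ) e
    where
    by-last : ∀ ρ → InitLast ρ → α ++ (x ++ ρ) ≡ w ∷ʳ a → ρ ≡ []
    by-last .[]         []         _ = refl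
    by-last .(β ∷ʳ b) (β ∷ʳ′ b) e = ⊥-elim (new (occurs-before-last α x β e))

  new-factor-is-suffix : ∀ {x} → Factor x (w ∷ʳ a) → ¬ Factor x w → Σ (Word k) λ α → α ++ x ≡ w ∷ʳ a
  new-factor-is-suffix {x} (α , ρ , e) new with refl ← new-occurrence-ends α x ρ e new =
    α , trans (cong (α ++_) (sym (LP.++-identityʳ x))) e

  -- If the palindrome x is new and a suffix of the palindromic suffix y,
  -- then x is a prefix of y followed by nothing, i.e. x = y.
  nested-new-palindromes : ∀ {x y δ β} → IsPal x → IsPal y → y ≡ δ ++ x → β ++ y ≡ w ∷ʳ a →
    ¬ Factor x w → x ≡ y
  nested-new-palindromes {x} {y} {δ} {β} x-pal y-pal y≡δx βy≡ new
    = sym (begin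
      y              ≡⟨ y≡xδ̄ ⟩
      x ++ reverse δ ≡⟨ cong (x ++_) (new-occurrence-ends β x (reverse δ) (subst (λ z → β ++ z ≡ w ∷ʳ a) y≡xδ̄ βy≡) new) ⟩
      x ++ []        ≡⟨ LP.++-identityʳ x ⟩
      x              ∎)
    where
    open ≡-Reasoning
    y≡xδ̄ : y ≡ x ++ reverse δ
    y≡xδ̄ = palindromic-suffix-is-prefix x-pal y-pal y≡δx

  new-palindrome-unique : ∀ {x y} → IsPal x → IsPal y → Factor x (w ∷ʳ a) → Factor y (w ∷ʳ a) →
    ¬ Factor x w → ¬ Factor y w → x ≡ y
  new-palindrome-unique {x} {y} x-pal y-pal x∈ y∈ x-new y-new
    with (α , αx≡) ← new-factor-is-suffix x∈ x-new | (β , βy≡) ← new-factor-is-suffix y∈ y-new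
    with suffixes-comparable α x β y (trans αx≡ (sym βy≡))
  ... | inj₁ (δ , y≡δx) = nested-new-palindromes x-pal y-pal y≡δx βy≡ x-new
  ... | inj₂ (δ , x≡δy) = sym (nested-new-palindromes y-pal x-pal x≡δy αx≡ y-new)

open NewFactors

module PalindromeCounts {k : ℕ} where

  NewPal : Word k → Word k → Set
  NewPal q x = IsPal x × ¬ x ∈ factors q

  newPal? : (q : Word k) → Decidable (NewPal q)
  newPal? q x = isPal? x ×-dec ¬? (isFactor? x q)

  numPal-++ : ∀ q r → numPal (q ++ r) ≡ numPal q + count (newPal? q) (factors (q ++ r))
  numPal-++ q r = begin
    count isPal? (factors (q ++ r))              ≡⟨ count-⊎ isPal? oldPal? (newPal? q) (factors (q ++ r))
                                                      (λ _ → old-or-new) (λ _ → palindrome) (λ _ (_ , old) (_ , new) → new old) ⟩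
    count oldPal? (factors (q ++ r)) + newCount  ≡⟨ cong (_+ newCount) old≡ ⟩
    numPal q + newCount                          ∎
    where
    open ≡-Reasoning
    newCount : ℕ
    newCount = count (newPal? q) (factors (q ++ r))
    oldPal? : Decidable (λ x → IsPal x × x ∈ factors q)
    oldPal? x = isPal? x ×-dec isFactor? x q
    old-or-new : ∀ {x} → IsPal x → (IsPal x × x ∈ factors q) ⊎ NewPal q x
    old-or-new {x} x-pal with isFactor? x q
    ... | yes old = inj₁ (x-pal , old)
    ... | no new  = inj₂ (x-pal , new)
    palindrome : ∀ {x} → (IsPal x × x ∈ factors q) ⊎ NewPal q x → IsPal x
    palindrome (inj₁ (x-pal , _)) = x-pal
    palindrome (inj₂ (x-pal , _)) = x-pal
    old≡ : count oldPal? (factors (q ++ r)) ≡ numPal q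
    old≡ = count-transfer oldPal? isPal? (factors-unique (q ++ r)) (factors-unique q)
      (λ _ (x-pal , x∈q) → x∈q , x-pal)
      (λ x∈q x-pal → factors-complete (factor-++ r (factors-sound q x∈q)) , x-pal , x∈q)

  numPal-∷ʳ : ∀ w a → numPal (w ∷ʳ a) ≤ suc (numPal w)
  numPal-∷ʳ w a = subst (_≤ suc (numPal w)) (sym (trans (numPal-++ w [ a ]) (+-comm (numPal w) _)))
    (+-monoˡ-≤ (numPal w) (count-≤1 (newPal? w) (factors-unique (w ∷ʳ a)) at-most-one))
    where
    at-most-one : ∀ {x y} → x ∈ factors (w ∷ʳ a) → NewPal w x → y ∈ factors (w ∷ʳ a) → NewPal w y → x ≡ y
    at-most-one x∈ (x-pal , x-new) y∈ (y-pal , y-new) =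
      new-palindrome-unique x-pal y-pal (factors-sound (w ∷ʳ a) x∈) (factors-sound (w ∷ʳ a) y∈)
        (x-new ∘ factors-complete) (y-new ∘ factors-complete)

  -- Palindromes of length in (m, L], where m bounds |q|, are never factors of q;
  -- so the new palindromic factors of p split into short ones and long ones.
  new-palindromes-by-length : ∀ p q m L → length q ≤ m → length p ≤ L →
    count (newPal? q) (factors p) ≡
    newPalCount p q m + count (λ x → isPal? x ×-dec ((m <? length x) ×-dec (length x ≤? L))) (factors p)
  new-palindromes-by-length p q m L |q|≤m |p|≤L =
    count-⊎ (newPal? q) (λ x → isPal? x ×-dec ((length x ≤? m) ×-dec ¬? (isFactor? x q)))
      (λ x → isPal? x ×-dec ((m <? length x) ×-dec (length x ≤? L))) (factors p)
      short-or-long (λ _ → new) (λ _ (_ , |x|≤m , _) (_ , m<|x| , _) → <⇒≱ m<|x| |x|≤m)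
    where
    short-or-long : ∀ {x} → x ∈ factors p → NewPal q x →
      (IsPal x × (length x ≤ m × ¬ x ∈ factors q)) ⊎ (IsPal x × (m < length x × length x ≤ L))
    short-or-long {x} x∈p (x-pal , x∉q) with length x ≤? m
    ... | yes short = inj₁ (x-pal , short , x∉q)
    ... | no long   = inj₂ (x-pal , ≰⇒> long , ≤-trans (factor-length (factors-sound p x∈p)) |p|≤L)
    new : ∀ {x} → (IsPal x × (length x ≤ m × ¬ x ∈ factors q)) ⊎ (IsPal x × (m < length x × length x ≤ L)) → NewPal q x
    new (inj₁ (x-pal , _ , x∉q)) = x-pal , x∉q
    new (inj₂ (x-pal , m<|x| , _)) = x-pal , λ x∈q → <⇒≱ m<|x| (≤-trans (factor-length (factors-sound q x∈q)) |q|≤m)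

open PalindromeCounts

length-pref : ∀ {k} (u : InfWord k) n → length (pref u n) ≡ n
length-pref u n = LP.length-tabulate _

pref-suc : ∀ {k} (u : InfWord k) n → pref u (suc n) ≡ pref u n ∷ʳ u n
pref-suc u zero    = refl
pref-suc u (suc n) = cong (u 0 ∷_) (pref-suc (λ j → u (suc j)) n)

pref-+ : ∀ {k} (u : InfWord k) m K → pref u (m + K) ≡ pref u m ++ pref (λ j → u (m + j)) K
pref-+ u zero    K = refl
pref-+ u (suc m) K = cong (u 0 ∷_) (pref-+ (λ j → u (suc j)) m K)

module PrefixDefect {k : ℕ} (u : InfWord k) where

  palPref : ℕ → ℕ
  palPref n = numPal (pref u n)

  palPref-suc : ∀ n → palPref (suc n) ≤ suc (palPref n)
  palPref-suc n = subst (λ z → numPal z ≤ suc (palPref n)) (sym (pref-suc u n)) (numPal-∷ʳ (pref u n) (u n))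

  palPref-bound : ∀ n → palPref n ≤ suc n
  palPref-bound zero    = ≤-refl
  palPref-bound (suc n) = ≤-trans (palPref-suc n) (s≤s (palPref-bound n))

  defect-pref : ∀ n → defect (pref u n) ≡ suc n ∸ palPref n
  defect-pref n = cong (λ l → suc l ∸ palPref n) (length-pref u n)

  -- Since palPref n ≤ n + 1, the defect is exactly the complement of palPref.
  palPref+defect : ∀ n → palPref n + defect (pref u n) ≡ suc n
  palPref+defect n = trans (cong (palPref n +_) (defect-pref n)) (m+[n∸m]≡n (palPref-bound n))

  defect-mono : ∀ m K → defect (pref u m) ≤ defect (pref u (m + K))
  defect-mono m zero    = subst (λ n → defect (pref u m) ≤ defect (pref u n)) (sym (+-identityʳ m)) ≤-refl
  defect-mono m (suc K) = subst (λ n → defect (pref u m) ≤ defect (pref u n)) (sym (+-suc m K))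
    (≤-trans (defect-mono m K) (step (m + K)))
    where
    step : ∀ n → defect (pref u n) ≤ defect (pref u (suc n))
    step n = subst₂ _≤_ (sym (defect-pref n)) (sym (defect-pref (suc n))) (∸-monoʳ-≤ (suc (suc n)) (palPref-suc n))

  palPref-linear : ∀ m → (∀ n → defect (pref u n) ≤ defect (pref u m)) → ∀ K → palPref (m + K) ≡ palPref m + K
  palPref-linear m maximal K = +-cancelʳ-≡ (defect (pref u m)) _ _ (begin
    palPref (m + K) + D m              ≡⟨ cong (palPref (m + K) +_) (sym constant) ⟩
    palPref (m + K) + D (m + K)        ≡⟨ palPref+defect (m + K) ⟩
    suc m + K                          ≡⟨ cong (_+ K) (sym (palPref+defect m)) ⟩
    (palPref m + D m) + K              ≡⟨ +-assoc (palPref m) (D m) K ⟩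
    palPref m + (D m + K)              ≡⟨ cong (palPref m +_) (+-comm (D m) K) ⟩
    palPref m + (K + D m)              ≡⟨ sym (+-assoc (palPref m) K (D m)) ⟩
    (palPref m + K) + D m              ∎)
    where
    open ≡-Reasoning
    D : ℕ → ℕ
    D n = defect (pref u n)
    constant : D (m + K) ≡ D m
    constant = ≤-antisym (maximal (m + K)) (defect-mono m K)

-- With q = u[0,m) of maximal defect and p = u[0,N), N = m + K:
--   |Pal(q)| + (#short new palindromes + #palindromes of length in (m, N])
--     = |Pal(q)| + #new palindromes     (new-palindromes-by-length)
--     = |Pal(p)|                         (numPal-++)
--     = |Pal(q)| + K                     (palPref-linear).
lemma10 : (k : ℕ) (u : InfWord k) → ClosedUnderReversal u → FiniteDefect u →
          (m : ℕ) → IsDefectOf u (defect (pref u m)) →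
          (N : ℕ) → m < N →
          newPalCount (pref u N) (pref u m) m + sumFromTo (palCount (pref u N)) m N ≡ N ∸ m
lemma10 k u _ _ m (maximal , _) N m<N = +-cancelˡ-≡ (numPal q) _ _ (begin
  numPal q + (newPalCount p q m + sumFromTo (palCount p) m N)
    ≡⟨ cong (λ s → numPal q + (newPalCount p q m + s)) (sum-count-by-length isPal? (factors p) m K) ⟩
  numPal q + (newPalCount p q m + count long? (factors p))
    ≡⟨ cong (numPal q +_) (sym (new-palindromes-by-length p q m (m + K) (≤-reflexive (length-pref u m)) |p|≤m+K)) ⟩
  numPal q + count (newPal? q) (factors p)
    ≡⟨ sym (subst (λ z → numPal z ≡ numPal q + count (newPal? q) (factors z)) (sym p≡qr) (numPal-++ q r)) ⟩
  numPal p
    ≡⟨ subst (λ n → palPref n ≡ palPref m + K) m+K≡N (palPref-linear m maximal K) ⟩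
  numPal q + K ∎)
  where
  open ≡-Reasoning
  open PrefixDefect u
  K = N ∸ m
  p = pref u N
  q = pref u m
  r = pref (λ j → u (m + j)) K
  m+K≡N : m + K ≡ N
  m+K≡N = m+[n∸m]≡n (<⇒≤ m<N)
  p≡qr : p ≡ q ++ r
  p≡qr = trans (cong (pref u) (sym m+K≡N)) (pref-+ u m K)
  |p|≤m+K : length p ≤ m + K
  |p|≤m+K = ≤-reflexive (trans (length-pref u N) (sym m+K≡N))
  long? : Decidable (λ (x : Word k) → IsPal x × (m < length x × length x ≤ m + K))
  long? x = isPal? x ×-dec ((m <? length x) ×-dec (length x ≤? m + K))
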